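{- Let $p$ be an odd prime and write $p-1 = 2^s\prod_{j=1}^k q_j^{\alpha_j}$, where $s\ge 1$, $k\ge 0$, the $q_j$ are distinct odd primes and $\alpha_j\ge 1$ (empty products are $1$). Then for every generator $g$ of $\mathbb{Z}_p^*$, $$|\mathcal{M}(g)| = \frac{p-1}{2\prod_{j=1}^k q_j}\Big[ \prod_{j=1}^k (q_j-1) - 2\prod_{j=1}^k (q_j-2) + \prod_{j=1}^k (q_j-3) \Big],$$ $$|\mathcal{NI}(g)| = \frac{p-1}{2\prod_{j=1}^k q_j}\Big[ \prod_{j=1}^k q_j - 2\prod_{j=1}^k (q_j-1) + \prod_{j=1}^k (q_j-2) \Big].$$
   Context: For an odd prime $p$, $\mathbb{Z}_p^*$ is the multiplicative group of nonzero residues mod $p$. Let $\mathcal{G}$ be the set of generators (primitive roots) of $\mathbb{Z}_p^*$, $\mathcal{R}$ the set of quadratic residues in $\mathbb{Z}_p^*$, and $\mathcal{NG}$ the set of quadratic non-residues that are not generators. For $g\in\mathcal{G}$ define $\mathcal{R}_g=\{r\in\mathcal{R}: gr\in\mathcal{G}\}$, $\bar{\mathcal{R}}_g=\{r\in\mathcal{R}: gr\in\mathcal{NG}\}$, $\mathcal{I}(g)=\mathcal{R}_g\cap\mathcal{R}_{g^{ -1}}$, $\mathcal{NI}(g)=\bar{\mathcal{R}}_g\cap\bar{\mathcal{R}}_{g^{ -1}}$, and the set of missing generators $\mathcal{M}(g)=\mathcal{G}\setminus\{gr,\ g^{ -1}r : r\in\mathcal{I}(g)\}$ (all products mod $p$).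 -}

module Defs where

open import Data.Nat using (ℕ; zero; suc; _+_; _*_; _∸_; _^_; _≤_; _<_; NonZero)
open import Data.Nat.DivMod using (_%_)
open import Data.Fin using (Fin)
import Data.Fin as Fin
open import Data.Integer as ℤ using (ℤ)
open import Data.List using (List; length)
open import Data.List.Membership.Propositional using (_∈_)
open import Data.List.Relation.Unary.Unique.Propositional using (Unique)
open import Data.Product using (Σ; ∃; ∃-syntax; _×_)
open import Data.Sum using (_⊎_)
open import Relation.Nullary using (¬_)
open import Relation.Binary.PropositionalEquality using (_≡_)
open import Function.Bundles using (_⇔_)

∏ : (k : ℕ) → (Fin k → ℕ) → ℕ
∏ zero    f = 1
∏ (suc k) f = f Fin.zero * ∏ k (λ j → f (Fin.suc j))

∏ℤ : (k : ℕ) → (Fin k → ℤ) → ℤ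
∏ℤ zero    f = ℤ.+ 1
∏ℤ (suc k) f = f Fin.zero ℤ.* ∏ℤ k (λ j → f (Fin.suc j))

HasSize : (ℕ → Set) → ℕ → Set
HasSize P n = Σ (List ℕ) λ L → Unique L × (∀ x → (x ∈ L ⇔ P x)) × length L ≡ n

-- Z_p^* is represented by the residues 1,…,p-1; products are taken mod p.
module _ (p : ℕ) .{{_ : NonZero p}} where

  Unit : ℕ → Set
  Unit x = 1 ≤ x × x < p

  _·_ : ℕ → ℕ → ℕ
  x · y = (x * y) % p

  IsGenerator : ℕ → Set
  IsGenerator g = Unit g × (∀ x → Unit x → ∃[ e ] (g ^ e) % p ≡ x)

  IsQR : ℕ → Set
  IsQR r = Unit r × ∃[ y ] (Unit y × y · y ≡ r)

  IsNG : ℕ → Set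
  IsNG x = Unit x × ¬ IsQR x × ¬ IsGenerator x

  IsInverse : ℕ → ℕ → Set
  IsInverse g h = Unit h × g · h ≡ 1

  Rset : ℕ → ℕ → Set
  Rset g r = IsQR r × IsGenerator (g · r)

  R̄set : ℕ → ℕ → Set
  R̄set g r = IsQR r × IsNG (g · r)

  Iset : (g h : ℕ) → ℕ → Set
  Iset g h r = Rset g r × Rset h r

  NIset : (g h : ℕ) → ℕ → Set
  NIset g h r = R̄set g r × R̄set h r

  Mset : (g h : ℕ) → ℕ → Set
  Mset g h x = IsGenerator x × ¬ (∃[ r ] (Iset g h r × (x ≡ g · r ⊎ x ≡ h · r)))

-- Write every unit of ℤ_p^* as a power gᵉ with e < n = p − 1. The quadratic residues are the even
-- exponents, the generators are the exponents prime to n, i.e. prime to 2 and to every qⱼ, and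
-- multiplication by g and g⁻¹ shifts the exponent by ±1 modulo n. Hence gᵉ ∈ NI(g) iff e is even
-- and neither e + 1 nor e − 1 is prime to n, and gᵉ ∈ M(g) iff e is prime to n but neither e + 2
-- nor e − 2 is. By inclusion–exclusion both counts reduce to counting the e < n of a fixed parity
-- such that e + s is prime to every qⱼ for all s in a set T of shifts that are pairwise
-- incongruent modulo every qⱼ; by the Chinese remainder theorem there are
-- n / (2 ∏ qⱼ) · ∏ (qⱼ − |T|) such e.

module Submission where

open import Defs
open import Data.Nat using (ℕ; _*_; _∸_; _^_; _≤_; NonZero)
open import Data.Nat.Primality using (Prime)
open import Data.Fin using (Fin)
open import Data.Integer as ℤ using (ℤ; +_)
open import Data.Product using (_×_; ∃-syntax)
open import Function.Definitions using (Injective)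
open import Relation.Nullary using (¬_)
open import Relation.Binary.PropositionalEquality using (_≡_)

open import Data.Bool using (Bool; true; false; not; _∧_)
open import Data.Empty using (⊥-elim)
open import Data.Fin as Fin using (toℕ)
open import Data.Fin.Properties using (∀-cons-⇔; pigeonhole; injective⇒≤; toℕ-fromℕ<; toℕ<n; toℕ-injective)
import Data.Integer.Properties as ℤ
import Data.Integer.Tactic.RingSolver as ℤ-Solver
open import Data.List using (List; []; _∷_; length; map; filter; downFrom)
open import Data.List.Membership.Propositional using (_∈_)
open import Data.List.Membership.Propositional.Properties
  using (∈-downFrom⁺; ∈-downFrom⁻; ∈-map∘filter⁺; ∈-map∘filter⁻)
open import Data.List.Properties using (length-map)
open import Data.List.Relation.Unary.All as All using (All; []; _∷_; all?)
open import Data.List.Relation.Unary.AllPairs using (AllPairs; []; _∷_)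
import Data.List.Relation.Unary.AllPairs.Properties as AllPairs
open import Data.List.Relation.Unary.Unique.Propositional using (Unique)
open import Data.Nat using (zero; suc; _+_; _<_; _%_; _/_; s≤s; z≤n; nonTrivial⇒n>1; >-nonZero)
open import Data.Nat.Coprimality using (Coprime; coprime?; coprime-Bézout; coprime-divisor)
open import Data.Nat.Divisibility
open import Data.Nat.DivMod
open import Data.Nat.GCD using (module Bézout)
open import Data.Nat.ListAction using (sum)
open import Data.Nat.Primality using (euclidsLemma; prime⇒irreducible; prime⇒nonTrivial; prime[2])
open import Data.Nat.Properties
open import Algebra.Properties.CommutativeSemigroup +-commutativeSemigroup using (interchange)
open import Data.Nat.Tactic.RingSolver using (solve-∀)
open import Data.Product using (_,_; proj₁; proj₂; ∃₂)
open import Data.Sum as Sum using (_⊎_; inj₁; inj₂)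
open import Data.Unit using (⊤; tt)
open import Function using (case_of_)
open import Function.Bundles using (_⇔_; mk⇔; Equivalence)
import Function.Properties.Equivalence as ⇔
open import Level using (0ℓ)
open import Relation.Binary.Definitions using (tri<; tri≈; tri>)
open import Relation.Binary.PropositionalEquality using (_≢_; refl; sym; trans; cong; cong₂; subst; ≢-sym; module ≡-Reasoning)
open import Relation.Nullary using (yes; no; does; ¬?; _×-dec_)
open import Relation.Nullary.Decidable using (dec-true; dec-false; does-⇔)
open import Relation.Unary using (Pred; Decidable)

-- Finite sums and counting

∑< : ℕ → (ℕ → ℕ) → ℕ
∑< zero    f = 0
∑< (suc n) f = ∑< n f + f n

syntax ∑< n (λ i → f) = ∑[ i < n ] f

∑<-cong : ∀ n {f g : ℕ → ℕ} → (∀ i → i < n → f i ≡ g i) → ∑< n f ≡ ∑< n g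
∑<-cong zero    f≗g = refl
∑<-cong (suc n) f≗g = cong₂ _+_ (∑<-cong n (λ i i<n → f≗g i (m<n⇒m<1+n i<n))) (f≗g n (n<1+n n))

∑<-const : ∀ n c → ∑[ i < n ] c ≡ n * c
∑<-const zero    c = refl
∑<-const (suc n) c = trans (cong (_+ c) (∑<-const n c)) (+-comm (n * c) c)

∑<-distrib-+ : ∀ n (f g : ℕ → ℕ) → ∑[ i < n ] (f i + g i) ≡ ∑< n f + ∑< n g
∑<-distrib-+ zero    f g = refl
∑<-distrib-+ (suc n) f g =
  trans (cong (_+ (f n + g n)) (∑<-distrib-+ n f g)) (interchange (∑< n f) (∑< n g) (f n) (g n))

∑<-distribˡ-* : ∀ n c (f : ℕ → ℕ) → ∑[ i < n ] (c * f i) ≡ c * ∑< n f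
∑<-distribˡ-* zero    c f = sym (*-zeroʳ c)
∑<-distribˡ-* (suc n) c f =
  trans (cong (_+ c * f n) (∑<-distribˡ-* n c f)) (sym (*-distribˡ-+ c (∑< n f) (f n)))

∑<-distribʳ-* : ∀ n c (f : ℕ → ℕ) → ∑[ i < n ] (f i * c) ≡ ∑< n f * c
∑<-distribʳ-* n c f = begin
  ∑[ i < n ] (f i * c) ≡⟨ ∑<-cong n (λ i _ → *-comm (f i) c) ⟩
  ∑[ i < n ] (c * f i) ≡⟨ ∑<-distribˡ-* n c f ⟩
  c * ∑< n f           ≡⟨ *-comm c (∑< n f) ⟩
  ∑< n f * c           ∎
  where open ≡-Reasoning

∑<-+ : ∀ m n (f : ℕ → ℕ) → ∑< (m + n) f ≡ ∑< m f + ∑[ i < n ] f (m + i)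
∑<-+ m zero    f = trans (cong (λ k → ∑< k f) (+-identityʳ m)) (sym (+-identityʳ (∑< m f)))
∑<-+ m (suc n) f = begin
  ∑< (m + suc n) f                                  ≡⟨ cong (λ k → ∑< k f) (+-suc m n) ⟩
  ∑< (m + n) f + f (m + n)                          ≡⟨ cong (_+ f (m + n)) (∑<-+ m n f) ⟩
  ∑< m f + ∑[ i < n ] f (m + i) + f (m + n)         ≡⟨ +-assoc (∑< m f) _ _ ⟩
  ∑< m f + (∑[ i < n ] f (m + i) + f (m + n))       ∎
  where open ≡-Reasoning

∑<-blocks : ∀ a q (f : ℕ → ℕ) → ∑< (a * q) f ≡ ∑[ t < q ] ∑[ x < a ] f (x + a * t)
∑<-blocks a zero    f = cong (λ k → ∑< k f) (*-zeroʳ a)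
∑<-blocks a (suc q) f = begin
  ∑< (a * suc q) f                                    ≡⟨ cong (λ k → ∑< k f) (trans (*-suc a q) (+-comm a (a * q))) ⟩
  ∑< (a * q + a) f                                    ≡⟨ ∑<-+ (a * q) a f ⟩
  ∑< (a * q) f + ∑[ x < a ] f (a * q + x)
    ≡⟨ cong₂ _+_ (∑<-blocks a q f) (∑<-cong a (λ x _ → cong f (+-comm (a * q) x))) ⟩
  ∑[ t < q ] ∑[ x < a ] f (x + a * t) + ∑[ x < a ] f (x + a * q) ∎
  where open ≡-Reasoning

∑<-swap : ∀ q a (f : ℕ → ℕ → ℕ) → ∑[ t < q ] ∑[ x < a ] f x t ≡ ∑[ x < a ] ∑[ t < q ] f x t
∑<-swap zero    a f = sym (trans (∑<-const a 0) (*-zeroʳ a))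
∑<-swap (suc q) a f =
  trans (cong (_+ ∑[ x < a ] f x q) (∑<-swap q a f)) (sym (∑<-distrib-+ a (λ x → ∑[ t < q ] f x t) (λ x → f x q)))

∑<-sum : ∀ n (T : List ℕ) (f : ℕ → ℕ → ℕ) →
  ∑[ i < n ] sum (map (f i) T) ≡ sum (map (λ s → ∑[ i < n ] f i s) T)
∑<-sum n []      f = trans (∑<-const n 0) (*-zeroʳ n)
∑<-sum n (s ∷ T) f =
  trans (∑<-distrib-+ n (λ i → f i s) (λ i → sum (map (f i) T))) (cong (λ z → ∑[ i < n ] f i s + z) (∑<-sum n T f))

𝟙 : Bool → ℕ
𝟙 true  = 1
𝟙 false = 0

𝟙-∧ : ∀ x y → 𝟙 (x ∧ y) ≡ 𝟙 x * 𝟙 y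
𝟙-∧ true  y = sym (+-identityʳ (𝟙 y))
𝟙-∧ false y = refl

count : {P : Pred ℕ 0ℓ} → Decidable P → ℕ → ℕ
count P? n = ∑[ e < n ] 𝟙 (does (P? e))

module _ {P : Pred ℕ 0ℓ} (P? : Decidable P) where

  count-cong : ∀ {Q} n (Q? : Decidable Q) → (∀ e → e < n → P e ⇔ Q e) → count P? n ≡ count Q? n
  count-cong n Q? P⇔Q = ∑<-cong n (λ e e<n → cong 𝟙 (does-⇔ (P⇔Q e e<n) (P? e) (Q? e)))

  count-none : ∀ n → (∀ e → e < n → ¬ P e) → count P? n ≡ 0
  count-none zero    none = refl
  count-none (suc n) none = cong₂ _+_ (count-none n (λ e e<n → none e (m<n⇒m<1+n e<n)))
                                      (cong 𝟙 (dec-false (P? n) (none n (n<1+n n))))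

count-≡ : ∀ {t n} → t < n → count (_≟ t) n ≡ 1
count-≡ {t} {suc n} t<1+n with t ≟ n
... | yes refl = cong₂ _+_ (count-none (_≟ t) n (λ e e<t e≡t → <-irrefl e≡t e<t)) (cong 𝟙 (dec-true (t ≟ t) refl))
... | no  t≢n  = trans
  (cong₂ _+_ (count-≡ (≤∧≢⇒< (≤-pred t<1+n) t≢n)) (cong 𝟙 (dec-false (n ≟ t) (≢-sym t≢n))))
  (+-identityʳ 1)

count-all : ∀ n → count {λ _ → ⊤} (λ _ → yes tt) n ≡ n
count-all n = trans (∑<-const n 1) (*-identityʳ n)

count-×-blocks : ∀ {A B : Pred ℕ 0ℓ} (A? : Decidable A) (B? : Decidable B) a q c →
  (∀ x t → B (x + a * t) ⇔ B x) → (∀ x → count (λ t → A? (x + a * t)) q ≡ c) →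
  count (λ e → A? e ×-dec B? e) (a * q) ≡ c * count B? a
count-×-blocks A? B? a q c B-periodic A-fibre = begin
  count (λ e → A? e ×-dec B? e) (a * q)
    ≡⟨ ∑<-blocks a q _ ⟩
  ∑[ t < q ] ∑[ x < a ] 𝟙 (does (A? (x + a * t)) ∧ does (B? (x + a * t)))
    ≡⟨ ∑<-cong q (λ t _ → ∑<-cong a (λ x _ → factor x t)) ⟩
  ∑[ t < q ] ∑[ x < a ] (𝟙 (does (A? (x + a * t))) * 𝟙 (does (B? x)))
    ≡⟨ ∑<-swap q a _ ⟩
  ∑[ x < a ] ∑[ t < q ] (𝟙 (does (A? (x + a * t))) * 𝟙 (does (B? x)))
    ≡⟨ ∑<-cong a (λ x _ → trans (∑<-distribʳ-* q _ _) (cong (_* 𝟙 (does (B? x))) (A-fibre x))) ⟩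
  ∑[ x < a ] (c * 𝟙 (does (B? x)))
    ≡⟨ ∑<-distribˡ-* a c _ ⟩
  c * count B? a ∎
  where
  open ≡-Reasoning
  factor : ∀ x t → 𝟙 (does (A? (x + a * t)) ∧ does (B? (x + a * t))) ≡ 𝟙 (does (A? (x + a * t))) * 𝟙 (does (B? x))
  factor x t = trans (𝟙-∧ (does (A? (x + a * t))) (does (B? (x + a * t))))
    (cong (λ b → 𝟙 (does (A? (x + a * t))) * 𝟙 b) (does-⇔ (B-periodic x t) (B? (x + a * t)) (B? x)))

count-periodic : ∀ {B : Pred ℕ 0ℓ} (B? : Decidable B) a t → (∀ x t → B (x + a * t) ⇔ B x) →
  count B? (a * t) ≡ t * count B? a
count-periodic B? a t B-periodic = count-×-blocks (λ _ → yes tt) B? a t t B-periodic (λ _ → count-all t)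

-- The trailing `∧ true`s are what `all?` computes to on explicit lists.
𝟙-exclusion : ∀ c a b →
  𝟙 (c ∧ (not a ∧ not b)) + 𝟙 (c ∧ (a ∧ true)) + 𝟙 (c ∧ (b ∧ true))
    ≡ 𝟙 (c ∧ true) + 𝟙 (c ∧ (a ∧ (b ∧ true)))
𝟙-exclusion false a     b     = refl
𝟙-exclusion true  false false = refl
𝟙-exclusion true  false true  = refl
𝟙-exclusion true  true  false = refl
𝟙-exclusion true  true  true  = refl

count-exclusion : ∀ {C : Pred ℕ 0ℓ} {P : ℕ → Pred ℕ 0ℓ} (C? : Decidable C) (P? : ∀ s → Decidable (P s)) a b n →
  let Cwith = λ L e → C? e ×-dec all? (λ s → P? s e) L in
  count (λ e → C? e ×-dec ¬? (P? a e) ×-dec ¬? (P? b e)) n + count (Cwith (a ∷ [])) n + count (Cwith (b ∷ [])) n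
    ≡ count (Cwith []) n + count (Cwith (a ∷ b ∷ [])) n
count-exclusion C? P? a b n = begin
  ∑< n f₁ + ∑< n f₂ + ∑< n f₃     ≡⟨ cong (_+ ∑< n f₃) (∑<-distrib-+ n f₁ f₂) ⟨
  ∑[ e < n ] (f₁ e + f₂ e) + ∑< n f₃ ≡⟨ ∑<-distrib-+ n _ f₃ ⟨
  ∑[ e < n ] (f₁ e + f₂ e + f₃ e)
    ≡⟨ ∑<-cong n (λ e _ → 𝟙-exclusion (does (C? e)) (does (P? a e)) (does (P? b e))) ⟩
  ∑[ e < n ] (g₁ e + g₂ e)         ≡⟨ ∑<-distrib-+ n g₁ g₂ ⟩
  ∑< n g₁ + ∑< n g₂                ∎
  where
  open ≡-Reasoning
  f₁ f₂ f₃ g₁ g₂ : ℕ → ℕ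
  f₁ e = 𝟙 (does (C? e) ∧ (not (does (P? a e)) ∧ not (does (P? b e))))
  f₂ e = 𝟙 (does (C? e) ∧ (does (P? a e) ∧ true))
  f₃ e = 𝟙 (does (C? e) ∧ (does (P? b e) ∧ true))
  g₁ e = 𝟙 (does (C? e) ∧ true)
  g₂ e = 𝟙 (does (C? e) ∧ (does (P? a e) ∧ (does (P? b e) ∧ true)))

-- Divisibility, coprimality and residues

prime>1 : ∀ {q} → Prime q → 1 < q
prime>1 {q} q-prime = nonTrivial⇒n>1 q {{prime⇒nonTrivial q-prime}}

prime∤⇒coprime : ∀ {q a} → Prime q → ¬ q ∣ a → Coprime a q
prime∤⇒coprime q-prime q∤a (d∣a , d∣q) with prime⇒irreducible q-prime d∣q
... | inj₁ d≡1 = d≡1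
... | inj₂ refl = ⊥-elim (q∤a d∣a)

coprime-* : ∀ {a b c} → Coprime a b → Coprime a c → Coprime a (b * c)
coprime-* a⊥b a⊥c (d∣a , d∣bc) =
  a⊥c (d∣a , coprime-divisor (λ (e∣d , e∣b) → a⊥b (∣-trans e∣d d∣a , e∣b)) d∣bc)

coprime-^ : ∀ {a b} → Coprime a b → ∀ m → Coprime a (b ^ m)
coprime-^ a⊥b zero    (_ , d∣1) = ∣1⇒≡1 d∣1
coprime-^ a⊥b (suc m) = coprime-* a⊥b (coprime-^ a⊥b m)

coprime-∏ : ∀ {a} m (f : Fin m → ℕ) → (∀ i → Coprime a (f i)) → Coprime a (∏ m f)
coprime-∏ zero    f a⊥f (_ , d∣1) = ∣1⇒≡1 d∣1
coprime-∏ (suc m) f a⊥f = coprime-* (a⊥f Fin.zero) (coprime-∏ m (λ i → f (Fin.suc i)) (λ i → a⊥f (Fin.suc i)))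

∣∏ : ∀ m (f : Fin m → ℕ) i → f i ∣ ∏ m f
∣∏ (suc m) f Fin.zero    = m∣m*n (∏ m (λ i → f (Fin.suc i)))
∣∏ (suc m) f (Fin.suc i) = ∣n⇒∣m*n (f Fin.zero) (∣∏ m (λ i → f (Fin.suc i)) i)

prime∣∏ : ∀ {x} m (f : Fin m → ℕ) → Prime x → x ∣ ∏ m f → ∃[ i ] x ∣ f i
prime∣∏ zero    f x-prime x∣1 = ⊥-elim (<-irrefl (sym (∣1⇒≡1 x∣1)) (prime>1 x-prime))
prime∣∏ (suc m) f x-prime x∣∏ with euclidsLemma (f Fin.zero) (∏ m (λ i → f (Fin.suc i))) x-prime x∣∏
... | inj₁ x∣f₀ = Fin.zero , x∣f₀
... | inj₂ x∣∏′ with prime∣∏ m (λ i → f (Fin.suc i)) x-prime x∣∏′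
...   | i , x∣fᵢ = Fin.suc i , x∣fᵢ

prime∤∏primes : ∀ {x} m (f : Fin m → ℕ) → Prime x → (∀ i → Prime (f i)) → (∀ i → f i ≢ x) →
  ¬ x ∣ ∏ m f
prime∤∏primes m f x-prime f-prime f≢x x∣∏ with prime∣∏ m f x-prime x∣∏
... | i , x∣fᵢ with prime⇒irreducible (f-prime i) x∣fᵢ
...   | inj₁ x≡1 = <-irrefl (sym x≡1) (prime>1 x-prime)
...   | inj₂ x≡fᵢ = f≢x i (sym x≡fᵢ)

∣^ : ∀ {r α} → 1 ≤ α → r ∣ r ^ α
∣^ {r} {suc α} _ = m∣m*n (r ^ α)

coprime-∏^⇔ : ∀ {a} m (r α : Fin m → ℕ) → (∀ i → Prime (r i)) → (∀ i → 1 ≤ α i) →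
  Coprime a (∏ m (λ i → r i ^ α i)) ⇔ (∀ i → ¬ r i ∣ a)
coprime-∏^⇔ {a} m r α r-prime α≥1 = mk⇔ to from
  where
  to : Coprime a (∏ m (λ i → r i ^ α i)) → ∀ i → ¬ r i ∣ a
  to a⊥∏ i rᵢ∣a =
    <-irrefl (sym (a⊥∏ (rᵢ∣a , ∣-trans (∣^ (α≥1 i)) (∣∏ m (λ i → r i ^ α i) i)))) (prime>1 (r-prime i))
  from : (∀ i → ¬ r i ∣ a) → Coprime a (∏ m (λ i → r i ^ α i))
  from r∤a = coprime-∏ m _ (λ i → coprime-^ (prime∤⇒coprime (r-prime i) (r∤a i)) (α i))

coprime-% : ∀ {a b n} .{{_ : NonZero n}} → a % n ≡ b % n → Coprime a n → Coprime b n
coprime-% a≡b a⊥n (d∣b , d∣n) = a⊥n (∣n∣m%n⇒∣m d∣n (subst (_ ∣_) (sym a≡b) (%-presˡ-∣ d∣b d∣n)) , d∣n)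

coprime⇒inverse : ∀ {a n} → 1 < n → Coprime a n → ∃₂ λ x k → a * x ≡ 1 + k * n
coprime⇒inverse {n = suc zero} (s≤s ()) _
coprime⇒inverse {a} {suc (suc m)} _ a⊥n with coprime-Bézout a⊥n
... | Bézout.+- x k 1+kn≡xa = x , k , trans (*-comm a x) (sym 1+kn≡xa)
... | Bézout.-+ x (suc k) 1+xa≡[1+k]n =
  -- x a ≡ −1, so a · x (n − 1) ≡ 1 − n ≡ 1 (mod n).
  x * suc m , m + k * suc m , (begin
    a * (x * suc m)                ≡⟨ *-assoc a x (suc m) ⟨
    a * x * suc m                  ≡⟨ cong (λ y → y * suc m) (trans (*-comm a x) xa≡) ⟩
    (suc m + k * (2 + m)) * suc m  ≡⟨ expand m k ⟩
    1 + (m + k * suc m) * (2 + m)  ∎)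
  where
  open ≡-Reasoning
  xa≡ : x * a ≡ suc m + k * (2 + m)
  xa≡ = suc-injective 1+xa≡[1+k]n
  expand : ∀ m k → (suc m + k * (2 + m)) * suc m ≡ 1 + (m + k * suc m) * (2 + m)
  expand = solve-∀

∏-mono-∣ : ∀ m (f g : Fin m → ℕ) → (∀ i → f i ∣ g i) → ∏ m f ∣ ∏ m g
∏-mono-∣ zero    f g f∣g = ∣-refl
∏-mono-∣ (suc m) f g f∣g =
  *-pres-∣ (f∣g Fin.zero) (∏-mono-∣ m (λ i → f (Fin.suc i)) (λ i → g (Fin.suc i)) (λ i → f∣g (Fin.suc i)))

%-distribˡ-^ : ∀ x b d .{{_ : NonZero d}} → x ^ b % d ≡ (x % d) ^ b % d
%-distribˡ-^ x zero    d = refl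
%-distribˡ-^ x (suc b) d = begin
  x * x ^ b % d                       ≡⟨ %-distribˡ-* x (x ^ b) d ⟩
  (x % d) * (x ^ b % d) % d           ≡⟨ cong (λ y → (x % d) * y % d) (%-distribˡ-^ x b d) ⟩
  (x % d) * ((x % d) ^ b % d) % d     ≡⟨ cong (λ y → y * ((x % d) ^ b % d) % d) (m%n%n≡m%n x d) ⟨
  (x % d % d) * ((x % d) ^ b % d) % d ≡⟨ %-distribˡ-* (x % d) ((x % d) ^ b) d ⟨
  (x % d) * (x % d) ^ b % d           ∎
  where open ≡-Reasoning

%≡⇒∣∸ : ∀ {a b d} .{{_ : NonZero d}} → b ≤ a → a % d ≡ b % d → d ∣ a ∸ b
%≡⇒∣∸ {a} {b} {d} b≤a a≡b = divides (a / d ∸ b / d) (begin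
  a ∸ b                                     ≡⟨ cong₂ _∸_ (m≡m%n+[m/n]*n a d) (m≡m%n+[m/n]*n b d) ⟩
  (a % d + a / d * d) ∸ (b % d + b / d * d) ≡⟨ cong (λ r → (r + a / d * d) ∸ (b % d + b / d * d)) a≡b ⟩
  (b % d + a / d * d) ∸ (b % d + b / d * d) ≡⟨ [m+n]∸[m+o]≡n∸o (b % d) _ _ ⟩
  a / d * d ∸ b / d * d                     ≡⟨ *-distribʳ-∸ d (a / d) (b / d) ⟨
  (a / d ∸ b / d) * d                       ∎)
  where open ≡-Reasoning

*-%prime-distinct : ∀ {p u v w} .{{_ : NonZero p}} → Prime p → ¬ p ∣ u → v < w → w < p →
  u * v % p ≢ u * w % p
*-%prime-distinct {p} {u} {v} {w} p-prime p∤u v<w w<p uv≡uw with euclidsLemma u (w ∸ v) p-prime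
  (subst (p ∣_) (sym (*-distribˡ-∸ u w v)) (%≡⇒∣∸ (*-monoʳ-≤ u (<⇒≤ v<w)) (sym uv≡uw)))
... | inj₁ p∣u   = p∤u p∣u
... | inj₂ p∣w∸v = <⇒≱ w<p (≤-trans (∣⇒≤ {{>-nonZero (m<n⇒0<n∸m v<w)}} p∣w∸v) (m∸n≤m w v))

*-cancelˡ-%prime : ∀ {p u v w} .{{_ : NonZero p}} → Prime p → ¬ p ∣ u → v < p → w < p →
  u * v % p ≡ u * w % p → v ≡ w
*-cancelˡ-%prime {v = v} {w} p-prime p∤u v<p w<p uv≡uw with <-cmp v w
... | tri< v<w _ _ = ⊥-elim (*-%prime-distinct p-prime p∤u v<w w<p uv≡uw)
... | tri≈ _ v≡w _ = v≡w
... | tri> _ _ w<v = ⊥-elim (*-%prime-distinct p-prime p∤u w<v v<p (sym uv≡uw))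

%-+-congˡ : ∀ {a b} c {n} .{{_ : NonZero n}} → a % n ≡ b % n → (c + a) % n ≡ (c + b) % n
%-+-congˡ {a} {b} c {n} a≡b =
  trans (%-distribˡ-+ c a n) (trans (cong (λ r → (c % n + r) % n) a≡b) (sym (%-distribˡ-+ c b n)))

even⊎odd : ∀ e → 2 ∣ e ⊎ 2 ∣ suc e
even⊎odd zero    = inj₁ (2 ∣0)
even⊎odd (suc e) with even⊎odd e
... | inj₁ 2∣e   = inj₂ (∣m∣n⇒∣m+n ∣-refl 2∣e)
... | inj₂ 2∣1+e = inj₁ 2∣1+e

even⇒odd-suc : ∀ {e} → 2 ∣ e → ¬ 2 ∣ suc e
even⇒odd-suc {e} 2∣e 2∣1+e with ∣1⇒≡1 (∣m+n∣m⇒∣n (subst (2 ∣_) (+-comm 1 e) 2∣1+e) 2∣e)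
... | ()

odd-suc⇒even : ∀ {e} → ¬ 2 ∣ suc e → 2 ∣ e
odd-suc⇒even {e} 2∤1+e with even⊎odd e
... | inj₁ 2∣e   = 2∣e
... | inj₂ 2∣1+e = ⊥-elim (2∤1+e 2∣1+e)

odd⇒even-suc : ∀ {e} → ¬ 2 ∣ e → 2 ∣ suc e
odd⇒even-suc {e} 2∤e with even⊎odd e
... | inj₁ 2∣e   = ⊥-elim (2∤e 2∣e)
... | inj₂ 2∣1+e = 2∣1+e

coprime-even⇒odd : ∀ {e n} → 2 ∣ n → Coprime e n → ¬ 2 ∣ e
coprime-even⇒odd 2∣n e⊥n 2∣e with e⊥n (2∣e , 2∣n)
... | ()

-- Sieving by residues modulo distinct primes

-- s ≢ s′ (mod q), stated without subtraction.
Incongruent : ℕ → ℕ → ℕ → Set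
Incongruent q s s′ = ∀ y → q ∣ s + y → ¬ q ∣ s′ + y

incongruent-sym : ∀ {q s s′} → Incongruent q s s′ → Incongruent q s′ s
incongruent-sym s≢s′ y q∣s′+y q∣s+y = s≢s′ y q∣s+y q∣s′+y

incongruent-offset : ∀ {q s s′} d N → q ∣ N → ¬ q ∣ d → (∀ y → s′ + y + d ≡ s + y + N) → Incongruent q s s′
incongruent-offset {q} d N q∣N q∤d shift y q∣s+y q∣s′+y =
  q∤d (∣m+n∣m⇒∣n (subst (q ∣_) (sym (shift y)) (∣m∣n⇒∣m+n q∣s+y q∣N)) q∣s′+y)

root-exists : ∀ {q a} → Prime q → ¬ q ∣ a → ∀ c → ∃[ t ] t < q × q ∣ c + a * t
root-exists {zero} q-prime with prime>1 q-prime
... | ()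
-- With a x ≡ 1 (mod q), t = x (q − 1) c gives c + a t ≡ q c ≡ 0; then reduce t modulo q.
root-exists {suc q′} {a} q-prime q∤a c with coprime⇒inverse (prime>1 q-prime) (prime∤⇒coprime q-prime q∤a)
... | x , k , ax≡1+kq = t % q , m%n<n t q , ∣m+n∣m⇒∣n (subst (q ∣_) split q∣c+at) (∣n⇒∣m*n (a * (t / q)) ∣-refl)
  where
  q = suc q′
  t = x * (q′ * c)
  q∣c+at : q ∣ c + a * t
  q∣c+at = divides (c + k * q′ * c) (begin
    c + a * (x * (q′ * c))   ≡⟨ cong (λ y → c + y) (*-assoc a x (q′ * c)) ⟨
    c + a * x * (q′ * c)     ≡⟨ cong (λ y → c + y * (q′ * c)) ax≡1+kq ⟩
    c + (1 + k * q) * (q′ * c) ≡⟨ expand c k q′ ⟩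
    (c + k * q′ * c) * q     ∎)
    where
    open ≡-Reasoning
    expand : ∀ c k q′ → c + (1 + k * suc q′) * (q′ * c) ≡ (c + k * q′ * c) * suc q′
    expand = solve-∀
  split : c + a * t ≡ a * (t / q) * q + (c + a * (t % q))
  split = begin
    c + a * t                       ≡⟨ cong (λ y → c + a * y) (m≡m%n+[m/n]*n t q) ⟩
    c + a * (t % q + t / q * q)     ≡⟨ rearrange c a (t % q) (t / q) q ⟩
    a * (t / q) * q + (c + a * (t % q)) ∎
    where
    open ≡-Reasoning
    rearrange : ∀ c a r d q → c + a * (r + d * q) ≡ a * d * q + (c + a * r)
    rearrange = solve-∀

root-unique : ∀ {q a c t t′} → Prime q → ¬ q ∣ a → t < t′ → t′ < q → q ∣ c + a * t → ¬ q ∣ c + a * t′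
root-unique {q} {a} {c} {t} q-prime q∤a t<t′ t′<q q∣c+at q∣c+at′ with m≤n⇒∃[o]m+o≡n t<t′
... | d , refl with euclidsLemma a (suc d) q-prime (∣m+n∣m⇒∣n (subst (q ∣_) split q∣c+at′) q∣c+at)
  where
  split : c + a * (suc t + d) ≡ c + a * t + a * suc d
  split = trans (cong (λ y → c + a * y) (sym (+-suc t d))) (rearrange c a t (suc d))
    where
    rearrange : ∀ c a t d → c + a * (t + d) ≡ c + a * t + a * d
    rearrange = solve-∀
...   | inj₁ q∣a   = q∤a q∣a
...   | inj₂ q∣1+d = <-irrefl refl (≤-trans t′<q (≤-trans (∣⇒≤ q∣1+d) (s≤s (m≤n+m d t))))

count-roots : ∀ {q a} → Prime q → ¬ q ∣ a → ∀ c → count (λ t → q ∣? c + a * t) q ≡ 1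
count-roots {q} {a} q-prime q∤a c with root-exists q-prime q∤a c
... | t₀ , t₀<q , root =
  trans (count-cong (λ t → q ∣? c + a * t) q (_≟ t₀) (λ t t<q → mk⇔ (unique t t<q) (λ { refl → root })))
        (count-≡ t₀<q)
  where
  unique : ∀ t → t < q → q ∣ c + a * t → t ≡ t₀
  unique t t<q q∣c+at with <-cmp t t₀
  ... | tri< t<t₀ _ _ = ⊥-elim (root-unique q-prime q∤a t<t₀ t₀<q q∣c+at root)
  ... | tri≈ _ t≡t₀ _ = t≡t₀
  ... | tri> _ _ t₀<t = ⊥-elim (root-unique q-prime q∤a t₀<t t<q root q∣c+at)

Avoids : ℕ → List ℕ → Pred ℕ 0ℓ
Avoids q T e = All (λ s → ¬ q ∣ s + e) T

avoids? : ∀ q T → Decidable (Avoids q T)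
avoids? q T e = all? (λ s → ¬? (q ∣? s + e)) T

avoids-periodic : ∀ {q d} T → q ∣ d → ∀ e → Avoids q T (e + d) ⇔ Avoids q T e
avoids-periodic {q} {d} T q∣d e =
  mk⇔ (All.map (λ q∤ q∣ → q∤ (shift⁺ q∣))) (All.map (λ q∤ q∣ → q∤ (shift⁻ q∣)))
  where
  assoc : ∀ {s} → s + (e + d) ≡ s + e + d
  assoc {s} = sym (+-assoc s e d)
  shift⁺ : ∀ {s} → q ∣ s + e → q ∣ s + (e + d)
  shift⁺ q∣s+e = subst (q ∣_) (sym assoc) (∣m∣n⇒∣m+n q∣s+e q∣d)
  shift⁻ : ∀ {s} → q ∣ s + (e + d) → q ∣ s + e
  shift⁻ {s} q∣ = ∣m+n∣m⇒∣n (subst (q ∣_) (trans assoc (+-comm (s + e) d)) q∣) q∣d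

hits : ℕ → List ℕ → ℕ → ℕ
hits q T e = sum (map (λ s → 𝟙 (does (q ∣? s + e))) T)

hits-avoided : ∀ {q} T {e} → Avoids q T e → hits q T e ≡ 0
hits-avoided []      []            = refl
hits-avoided (s ∷ T) (q∤ ∷ avoid) = cong₂ _+_ (cong 𝟙 (dec-false (_ ∣? _) q∤)) (hits-avoided T avoid)

𝟙-avoids+hits : ∀ {q T} → AllPairs (Incongruent q) T → ∀ e → 𝟙 (does (avoids? q T e)) + hits q T e ≡ 1
𝟙-avoids+hits []                  e = refl
𝟙-avoids+hits {q} {s ∷ T} (s≢ ∷ pairs) e with q ∣? s + e
... | yes q∣s+e = cong suc (hits-avoided T (All.map (λ s≢s′ → s≢s′ e q∣s+e) s≢))
... | no  _     = 𝟙-avoids+hits pairs e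

sum-map-1 : ∀ (f : ℕ → ℕ) T → (∀ s → f s ≡ 1) → sum (map f T) ≡ length T
sum-map-1 f []      f≡1 = refl
sum-map-1 f (s ∷ T) f≡1 = cong₂ _+_ (f≡1 s) (sum-map-1 f T f≡1)

-- Each t < q avoids T or hits exactly one shift of T, and each shift is hit by exactly one t.
count-avoiding : ∀ {q a T} → Prime q → ¬ q ∣ a → AllPairs (Incongruent q) T →
  ∀ x → count (λ t → avoids? q T (x + a * t)) q ≡ q ∸ length T
count-avoiding {q} {a} {T} q-prime q∤a pairs x = begin
  A                  ≡⟨ m+n∸n≡m A (length T) ⟨
  A + length T ∸ length T ≡⟨ cong (λ h → A + h ∸ length T) all-hits ⟨
  A + H ∸ length T   ≡⟨ cong (_∸ length T) (∑<-distrib-+ q _ _) ⟨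
  ∑[ t < q ] (𝟙 (does (avoids? q T (x + a * t))) + hits q T (x + a * t)) ∸ length T
                     ≡⟨ cong (_∸ length T) (∑<-cong q (λ t _ → 𝟙-avoids+hits pairs (x + a * t))) ⟩
  ∑[ t < q ] 1 ∸ length T ≡⟨ cong (_∸ length T) (trans (∑<-const q 1) (*-identityʳ q)) ⟩
  q ∸ length T       ∎
  where
  open ≡-Reasoning
  A = count (λ t → avoids? q T (x + a * t)) q
  H = ∑[ t < q ] hits q T (x + a * t)
  hits-of : ∀ s → ∑[ t < q ] 𝟙 (does (q ∣? s + (x + a * t))) ≡ 1
  hits-of s = trans (∑<-cong q (λ t _ → cong (λ y → 𝟙 (does (q ∣? y))) (sym (+-assoc s x (a * t)))))
                    (count-roots q-prime q∤a (s + x))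
  all-hits : H ≡ length T
  all-hits = trans (∑<-sum q T (λ t s → 𝟙 (does (q ∣? s + (x + a * t))))) (sum-map-1 _ T hits-of)

Sieved : ∀ m → (Fin m → ℕ) → (Fin m → List ℕ) → Pred ℕ 0ℓ
Sieved m r T e = ∀ i → Avoids (r i) (T i) e

sieved? : ∀ m r T → Decidable (Sieved m r T)
sieved? m r T e = Data.Fin.Properties.all? (λ i → avoids? (r i) (T i) e)

sieved-periodic : ∀ {d} m r T → (∀ i → r i ∣ d) → ∀ e → Sieved m r T (e + d) ⇔ Sieved m r T e
sieved-periodic m r T r∣d e = mk⇔ (λ sv i → Equivalence.to (avoids-periodic (T i) (r∣d i) e) (sv i))
                                  (λ sv i → Equivalence.from (avoids-periodic (T i) (r∣d i) e) (sv i))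

-- Split [0, r₀ R) into the blocks x + R t with t < r₀: the condition on the other primes is
-- R-periodic, and since r₀ ∤ R, x + R t runs through all residues modulo r₀.
count-sieved : ∀ m (r : Fin m → ℕ) T → (∀ i → Prime (r i)) → Injective _≡_ _≡_ r →
  (∀ i → AllPairs (Incongruent (r i)) (T i)) → count (sieved? m r T) (∏ m r) ≡ ∏ m (λ i → r i ∸ length (T i))
count-sieved zero    r T _ _ _ = cong 𝟙 (dec-true (sieved? zero r T 0) (λ ()))
count-sieved (suc m) r T r-prime r-injective pairs = begin
  count (sieved? (suc m) r T) (r₀ * R)
    ≡⟨ count-cong (sieved? (suc m) r T) (r₀ * R) (λ e → avoids? r₀ (T Fin.zero) e ×-dec sieved? m r′ T′ e)
         (λ e _ → ⇔.sym (∀-cons-⇔ {P = λ i → Avoids (r i) (T i) e})) ⟩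
  count (λ e → avoids? r₀ (T Fin.zero) e ×-dec sieved? m r′ T′ e) (r₀ * R)
    ≡⟨ cong (count (λ e → avoids? r₀ (T Fin.zero) e ×-dec sieved? m r′ T′ e)) (*-comm r₀ R) ⟩
  count (λ e → avoids? r₀ (T Fin.zero) e ×-dec sieved? m r′ T′ e) (R * r₀)
    ≡⟨ count-×-blocks (avoids? r₀ (T Fin.zero)) (sieved? m r′ T′) R r₀ _ tail-periodic
         (count-avoiding (r-prime Fin.zero) r₀∤R (pairs Fin.zero)) ⟩
  (r₀ ∸ length (T Fin.zero)) * count (sieved? m r′ T′) R
    ≡⟨ cong ((r₀ ∸ length (T Fin.zero)) *_) (count-sieved m r′ T′ (λ i → r-prime (Fin.suc i))
         (λ eq → Data.Fin.Properties.suc-injective (r-injective eq)) (λ i → pairs (Fin.suc i))) ⟩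
  (r₀ ∸ length (T Fin.zero)) * ∏ m (λ i → r′ i ∸ length (T′ i)) ∎
  where
  open ≡-Reasoning
  r₀ = r Fin.zero
  r′ = λ i → r (Fin.suc i)
  T′ = λ i → T (Fin.suc i)
  R = ∏ m r′
  r₀∤R : ¬ r₀ ∣ R
  r₀∤R = prime∤∏primes m r′ (r-prime Fin.zero) (λ i → r-prime (Fin.suc i))
           (λ i eq → Data.Fin.Properties.0≢1+n (sym (r-injective eq)))
  tail-periodic : ∀ x t → Sieved m r′ T′ (x + R * t) ⇔ Sieved m r′ T′ x
  tail-periodic x t = sieved-periodic m r′ T′ (λ i → ∣m⇒∣m*n t (∣∏ m r′ i)) x

-- Discrete logarithms modulo an odd prime

unit⇒∤ : ∀ {p x} .{{_ : NonZero p}} → Unit p x → ¬ p ∣ x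
unit⇒∤ (1≤x , x<p) p∣x = <⇒≱ x<p (∣⇒≤ {{>-nonZero 1≤x}} p∣x)

module DiscreteLog (u : ℕ) (p-prime : Prime (3 + u)) {g : ℕ} (g-gen : IsGenerator (3 + u) g) where

  n p : ℕ
  n = 2 + u
  p = 3 + u

  pow : ℕ → ℕ
  pow e = g ^ e % p

  p∤g^ : ∀ e → ¬ p ∣ g ^ e
  p∤g^ zero    p∣1 = <-irrefl (sym (∣1⇒≡1 p∣1)) (prime>1 p-prime)
  p∤g^ (suc e) p∣g^1+e with euclidsLemma g (g ^ e) p-prime p∣g^1+e
  ... | inj₁ p∣g   = unit⇒∤ (proj₁ g-gen) p∣g
  ... | inj₂ p∣g^e = p∤g^ e p∣g^e

  pow-unit : ∀ e → Unit p (pow e)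
  pow-unit e = n≢0⇒n>0 (λ g^e%p≡0 → p∤g^ e (m%n≡0⇒n∣m (g ^ e) p g^e%p≡0)) , m%n<n (g ^ e) p

  pow-+ : ∀ a b → pow (a + b) ≡ pow a * pow b % p
  pow-+ a b = trans (cong (_% p) (^-distribˡ-+-* g a b)) (%-distribˡ-* (g ^ a) (g ^ b) p)

  pow-* : ∀ a b → pow (a * b) ≡ pow a ^ b % p
  pow-* a b = trans (cong (_% p) (sym (^-*-assoc g a b))) (%-distribˡ-^ (g ^ a) b p)

  pow-1 : pow 1 ≡ g
  pow-1 = trans (cong (_% p) (*-identityʳ g)) (m<n⇒m%n≡m (proj₂ (proj₁ g-gen)))

  pow-cancel : ∀ a d → pow (a + d) ≡ pow a → pow d ≡ 1
  pow-cancel a d a+d≡a = *-cancelˡ-%prime p-prime (unit⇒∤ (pow-unit a)) (proj₂ (pow-unit d)) (prime>1 p-prime) (begin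
    pow a * pow d % p ≡⟨ pow-+ a d ⟨
    pow (a + d)       ≡⟨ a+d≡a ⟩
    pow a             ≡⟨ m%n%n≡m%n (g ^ a) p ⟨
    pow a % p         ≡⟨ cong (_% p) (*-identityʳ (pow a)) ⟨
    pow a * 1 % p     ∎)
    where open ≡-Reasoning

  pow-period : ∀ d → pow d ≡ 1 → ∀ a b → pow (a + d * b) ≡ pow a
  pow-period d d-period a b = begin
    pow (a + d * b)          ≡⟨ pow-+ a (d * b) ⟩
    pow a * pow (d * b) % p  ≡⟨ cong (λ y → pow a * y % p) (pow-* d b) ⟩
    pow a * (pow d ^ b % p) % p ≡⟨ cong (λ y → pow a * (y ^ b % p) % p) d-period ⟩
    pow a * (1 ^ b % p) % p  ≡⟨ cong (λ y → pow a * (y % p) % p) (^-zeroˡ b) ⟩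
    pow a * 1 % p            ≡⟨ cong (_% p) (*-identityʳ (pow a)) ⟩
    pow a % p                ≡⟨ m%n%n≡m%n (g ^ a) p ⟩
    pow a                    ∎
    where open ≡-Reasoning

  pow-% : ∀ d .{{_ : NonZero d}} → pow d ≡ 1 → ∀ e → pow e ≡ pow (e % d)
  pow-% d d-period e = begin
    pow e                   ≡⟨ cong pow (m≡m%n+[m/n]*n e d) ⟩
    pow (e % d + e / d * d) ≡⟨ cong (λ y → pow (e % d + y)) (*-comm (e / d) d) ⟩
    pow (e % d + d * (e / d)) ≡⟨ pow-period d d-period (e % d) (e / d) ⟩
    pow (e % d)             ∎
    where open ≡-Reasoning

  log : ∀ {x} → Unit p x → ∃[ e ] pow e ≡ x
  log {x} x-unit = proj₂ g-gen x x-unit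

  index : ℕ → Fin n
  index e = Fin.fromℕ< (∸-monoˡ-< (proj₂ (pow-unit e)) (proj₁ (pow-unit e)))

  index-injective : ∀ a b → index a ≡ index b → pow a ≡ pow b
  index-injective a b ia≡ib = ∸-cancelʳ-≡ (proj₁ (pow-unit a)) (proj₁ (pow-unit b))
    (trans (sym (toℕ-fromℕ< _)) (trans (cong toℕ ia≡ib) (toℕ-fromℕ< _)))

  -- The order of g is n: among n + 1 powers two must coincide, and a period d < n would leave
  -- only d values for the n units.
  order≤n : ∃[ d ] pow (suc d) ≡ 1 × suc d ≤ n
  order≤n with pigeonhole (n<1+n n) (λ i → index (toℕ i))
  ... | i , j , i<j , index-i≡j with m≤n⇒∃[o]m+o≡n i<j
  ...   | d , i+1+d≡j = d , pow-cancel (toℕ i) (suc d) i+[1+d]≡i , 1+d≤n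
    where
    i+[1+d]≡j : toℕ i + suc d ≡ toℕ j
    i+[1+d]≡j = trans (+-suc (toℕ i) d) i+1+d≡j
    i+[1+d]≡i : pow (toℕ i + suc d) ≡ pow (toℕ i)
    i+[1+d]≡i = trans (cong pow i+[1+d]≡j) (sym (index-injective (toℕ i) (toℕ j) index-i≡j))
    1+d≤n : suc d ≤ n
    1+d≤n = ≤-trans (m≤n+m (suc d) (toℕ i)) (subst (_≤ n) (sym i+[1+d]≡j) (≤-pred (toℕ<n j)))

  n≤order : ∀ d → pow (suc d) ≡ 1 → n ≤ suc d
  n≤order d d-period = injective⇒≤ reduce-injective
    where
    logᵢ : Fin n → ℕ
    logᵢ i = proj₁ (log (s≤s z≤n , s≤s (toℕ<n i)))
    reduce : Fin n → Fin (suc d)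
    reduce i = Fin.fromℕ< (m%n<n (logᵢ i) (suc d))
    reduce-injective : Injective _≡_ _≡_ reduce
    reduce-injective {i} {j} ri≡rj = toℕ-injective (suc-injective (begin
      suc (toℕ i)                 ≡⟨ proj₂ (log _) ⟨
      pow (logᵢ i)                ≡⟨ pow-% (suc d) d-period (logᵢ i) ⟩
      pow (logᵢ i % suc d)
        ≡⟨ cong pow (trans (sym (toℕ-fromℕ< _)) (trans (cong toℕ ri≡rj) (toℕ-fromℕ< _))) ⟩
      pow (logᵢ j % suc d)        ≡⟨ pow-% (suc d) d-period (logᵢ j) ⟨
      pow (logᵢ j)                ≡⟨ proj₂ (log _) ⟩
      suc (toℕ j)                 ∎))
      where open ≡-Reasoning

  pow-n : pow n ≡ 1
  pow-n = period-is-n order≤n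
    where
    period-is-n : ∃[ d ] pow (suc d) ≡ 1 × suc d ≤ n → pow n ≡ 1
    period-is-n (d , d-period , 1+d≤n) = subst (λ k → pow k ≡ 1) (≤-antisym 1+d≤n (n≤order d d-period)) d-period

  pow-mod : ∀ e → pow e ≡ pow (e % n)
  pow-mod = pow-% n pow-n

  pow-+n : ∀ e → pow (e + n) ≡ pow e
  pow-+n e = trans (cong (λ k → pow (e + k)) (sym (*-identityʳ n))) (pow-period n pow-n e 1)

  pow-distinct : ∀ {a b} → a < b → b < n → pow a ≢ pow b
  pow-distinct {a} a<b b<n a≡b with m≤n⇒∃[o]m+o≡n a<b
  ... | d , refl = <⇒≱ b<n (≤-trans (n≤order d (pow-cancel a (suc d) a+[1+d]≡a)) (s≤s (m≤n+m d a)))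
    where
    a+[1+d]≡a : pow (a + suc d) ≡ pow a
    a+[1+d]≡a = trans (cong pow (+-suc a d)) (sym a≡b)

  pow-injective : ∀ {a b} → a < n → b < n → pow a ≡ pow b → a ≡ b
  pow-injective {a} {b} a<n b<n a≡b with <-cmp a b
  ... | tri< a<b _ _ = ⊥-elim (pow-distinct a<b b<n a≡b)
  ... | tri≈ _ a≡b _ = a≡b
  ... | tri> _ _ b<a = ⊥-elim (pow-distinct b<a a<n (sym a≡b))

  pow-≡⇒%≡ : ∀ {a b} → pow a ≡ pow b → a % n ≡ b % n
  pow-≡⇒%≡ {a} {b} a≡b = pow-injective (m%n<n a n) (m%n<n b n) (trans (sym (pow-mod a)) (trans a≡b (pow-mod b)))

  log< : ∀ {x} → Unit p x → ∃[ e ] e < n × pow e ≡ x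
  log< x-unit with log x-unit
  ... | e , e≡x = e % n , m%n<n e n , trans (sym (pow-mod e)) e≡x

  isQR⇔even : 2 ∣ n → ∀ e → IsQR p (pow e) ⇔ 2 ∣ e
  isQR⇔even 2∣n e = mk⇔ to from
    where
    square : ∀ c → pow c * pow c % p ≡ pow (2 * c)
    square c = trans (sym (pow-+ c c)) (cong (λ k → pow (c + k)) (sym (+-identityʳ c)))
    to : IsQR p (pow e) → 2 ∣ e
    to (_ , y , y-unit , y²≡e) with log y-unit
    ... | c , refl = ∣n∣m%n⇒∣m 2∣n (subst (2 ∣_) (pow-≡⇒%≡ {2 * c} {e} (trans (sym (square c)) y²≡e))
                                                   (%-presˡ-∣ (m∣m*n c) 2∣n))
    from : 2 ∣ e → IsQR p (pow e)
    from (divides c refl) = pow-unit (c * 2) , pow c , pow-unit c , trans (square c) (cong pow (*-comm 2 c))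

  isGenerator⇔coprime : ∀ e → IsGenerator p (pow e) ⇔ Coprime e n
  isGenerator⇔coprime e = mk⇔ to from
    where
    to : IsGenerator p (pow e) → Coprime e n
    to (_ , generates) {d} (d∣e , d∣n) with generates g (proj₁ g-gen)
    ... | k , e^k≡g = ∣1⇒≡1 (∣n∣m%n⇒∣m d∣n (subst (d ∣_) ek≡1 (%-presˡ-∣ (∣m⇒∣m*n k d∣e) d∣n)))
      where
      ek≡1 : e * k % n ≡ 1 % n
      ek≡1 = pow-≡⇒%≡ {e * k} {1} (trans (pow-* e k) (trans e^k≡g (sym pow-1)))
    from : Coprime e n → IsGenerator p (pow e)
    from e⊥n with coprime⇒inverse (s≤s (s≤s z≤n)) e⊥n
    ... | x , k , ex≡1+kn = pow-unit e , reach
      where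
      reach : ∀ y → Unit p y → ∃[ m ] pow e ^ m % p ≡ y
      reach y y-unit with log y-unit
      ... | f , refl = x * f , (begin
        pow e ^ (x * f) % p   ≡⟨ pow-* e (x * f) ⟨
        pow (e * (x * f))     ≡⟨ cong pow (*-assoc e x f) ⟨
        pow (e * x * f)       ≡⟨ cong (λ z → pow (z * f)) ex≡1+kn ⟩
        pow ((1 + k * n) * f) ≡⟨ cong pow (distribute k n f) ⟩
        pow (f + n * (k * f)) ≡⟨ pow-period n pow-n f (k * f) ⟩
        pow f                 ∎)
        where
        open ≡-Reasoning
        distribute : ∀ k n f → (1 + k * n) * f ≡ f + n * (k * f)
        distribute = solve-∀

  isNG⇔ : 2 ∣ n → ∀ e → IsNG p (pow e) ⇔ (¬ 2 ∣ e × ¬ Coprime e n)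
  isNG⇔ 2∣n e = mk⇔
    (λ (_ , ¬qr , ¬gen) → (λ 2∣e → ¬qr (Equivalence.from (isQR⇔even 2∣n e) 2∣e))
                        , (λ e⊥n → ¬gen (Equivalence.from (isGenerator⇔coprime e) e⊥n)))
    (λ (2∤e , ¬e⊥n) → pow-unit e , (λ qr → 2∤e (Equivalence.to (isQR⇔even 2∣n e) qr))
                                 , (λ gen → ¬e⊥n (Equivalence.to (isGenerator⇔coprime e) gen)))

  g-shift : ∀ e → g * pow e % p ≡ pow (1 + e)
  g-shift e = trans (cong (λ y → y * pow e % p) (sym pow-1)) (sym (pow-+ 1 e))

  inverse≡pow : ∀ {h} → IsInverse p g h → h ≡ pow (1 + u)
  inverse≡pow (h-unit , gh≡1) =
    *-cancelˡ-%prime p-prime (unit⇒∤ (proj₁ g-gen)) (proj₂ h-unit) (proj₂ (pow-unit (1 + u)))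
      (trans gh≡1 (sym (trans (g-shift (1 + u)) pow-n)))

  hasSize : ∀ {S D : Pred ℕ 0ℓ} (D? : Decidable D) → (∀ {x} → S x → Unit p x) →
    (∀ e → e < n → S (pow e) ⇔ D e) → HasSize S (count D? n)
  hasSize {S} {D} D? S⇒unit S⇔D = map pow (filter D? (downFrom n)) , unique , membership , size
    where
    distinct : ∀ k → k ≤ n → AllPairs (λ a b → pow a ≢ pow b) (downFrom k)
    distinct zero    _     = []
    distinct (suc k) 1+k≤n = All.tabulate (λ b∈ → ≢-sym (pow-distinct (∈-downFrom⁻ b∈) 1+k≤n))
                             ∷ distinct k (≤-trans (n≤1+n k) 1+k≤n)
    unique : Unique (map pow (filter D? (downFrom n)))
    unique = AllPairs.map⁺ (AllPairs.filter⁺ D? (distinct n ≤-refl))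
    membership : ∀ x → x ∈ map pow (filter D? (downFrom n)) ⇔ S x
    membership x = mk⇔
      (λ x∈ → case ∈-map∘filter⁻ pow D? x∈ of λ (e , e∈ , x≡ , De) →
                 subst S (sym x≡) (Equivalence.from (S⇔D e (∈-downFrom⁻ e∈)) De))
      (λ Sx → case log< (S⇒unit Sx) of λ (e , e<n , e≡x) →
                 ∈-map∘filter⁺ pow D?
                   (e , ∈-downFrom⁺ e<n , sym e≡x , Equivalence.to (S⇔D e e<n) (subst S (sym e≡x) Sx)))
    length-filter : ∀ k → length (filter D? (downFrom k)) ≡ count D? k
    length-filter zero    = refl
    length-filter (suc k) with does (D? k)
    ... | true  = trans (cong suc (length-filter k)) (+-comm 1 (count D? k))
    ... | false = trans (length-filter k) (sym (+-identityʳ (count D? k)))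
    size : length (map pow (filter D? (downFrom n))) ≡ count D? n
    size = trans (length-map pow (filter D? (downFrom n))) (length-filter n)

-- The exponents of M(g) and NI(g)

-- With n = 2 + u: u + e ≡ e − 2 and suc u + e ≡ e − 1 (mod n).
MissingExponent NIExponent : ℕ → Pred ℕ 0ℓ
MissingExponent u e = Coprime e (2 + u) × ¬ Coprime (2 + e) (2 + u) × ¬ Coprime (u + e) (2 + u)
NIExponent u e      = 2 ∣ e × ¬ Coprime (1 + e) (2 + u) × ¬ Coprime (suc u + e) (2 + u)

missing? : ∀ u → Decidable (MissingExponent u)
missing? u e = coprime? e (2 + u) ×-dec ¬? (coprime? (2 + e) (2 + u)) ×-dec ¬? (coprime? (u + e) (2 + u))

ni? : ∀ u → Decidable (NIExponent u)
ni? u e = 2 ∣? e ×-dec ¬? (coprime? (1 + e) (2 + u)) ×-dec ¬? (coprime? (suc u + e) (2 + u))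

module ExponentSets (u : ℕ) (p-prime : Prime (3 + u)) {g h : ℕ} (g-gen : IsGenerator (3 + u) g)
                    (h-inv : IsInverse (3 + u) g h) (2∣u : 2 ∣ u) where

  open DiscreteLog u p-prime g-gen

  2∣n : 2 ∣ n
  2∣n = ∣m∣n⇒∣m+n ∣-refl 2∣u

  h-shift : ∀ e → h * pow e % p ≡ pow (suc u + e)
  h-shift e = trans (cong (λ y → y * pow e % p) (inverse≡pow h-inv)) (sym (pow-+ (suc u) e))

  -- Exponent arithmetic of g⁻¹ = g ^ (1 + u): g⁻¹ g = g g⁻¹ = 1 and g⁻¹ g⁻¹ = g ^ u.
  g⁻¹g : ∀ e → suc u + (1 + e) ≡ e + n
  g⁻¹g e = identity u e
    where
    identity : ∀ u e → suc u + (1 + e) ≡ e + (2 + u)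
    identity = solve-∀

  gg⁻¹ : ∀ e → 1 + (suc u + e) ≡ e + n
  gg⁻¹ e = identity u e
    where
    identity : ∀ u e → 1 + (suc u + e) ≡ e + (2 + u)
    identity = solve-∀

  g⁻¹g⁻¹ : ∀ e → suc u + (suc u + e) ≡ (u + e) + n
  g⁻¹g⁻¹ e = identity u e
    where
    identity : ∀ u e → suc u + (suc u + e) ≡ (u + e) + (2 + u)
    identity = solve-∀

  coprime-+n : ∀ {a b} → a ≡ b + n → Coprime b n → Coprime a n
  coprime-+n {a} {b} a≡b+n = coprime-% (sym (trans (cong (_% n) a≡b+n) ([m+n]%n≡m%n b n)))

  NI⇔ : ∀ e → NIset p g h (pow e) ⇔ NIExponent u e
  NI⇔ e = mk⇔
    (λ ((qr , ng-g) , (_ , ng-h)) →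
        Equivalence.to (isQR⇔even 2∣n e) qr
      , proj₂ (Equivalence.to (isNG⇔ 2∣n (1 + e)) (subst (IsNG p) (g-shift e) ng-g))
      , proj₂ (Equivalence.to (isNG⇔ 2∣n (suc u + e)) (subst (IsNG p) (h-shift e) ng-h)))
    (λ (2∣e , ¬1+e⊥n , ¬1+u+e⊥n) →
      let qr = Equivalence.from (isQR⇔even 2∣n e) 2∣e in
        (qr , subst (IsNG p) (sym (g-shift e)) (Equivalence.from (isNG⇔ 2∣n (1 + e)) (even⇒odd-suc 2∣e , ¬1+e⊥n)))
      , (qr , subst (IsNG p) (sym (h-shift e))
                (Equivalence.from (isNG⇔ 2∣n (suc u + e)) (even⇒odd-suc (∣m∣n⇒∣m+n 2∣u 2∣e) , ¬1+u+e⊥n))))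

  I⇔ : ∀ f → Iset p g h (pow f) ⇔ (2 ∣ f × Coprime (1 + f) n × Coprime (suc u + f) n)
  I⇔ f = mk⇔
    (λ ((qr , gen-g) , (_ , gen-h)) →
        Equivalence.to (isQR⇔even 2∣n f) qr
      , Equivalence.to (isGenerator⇔coprime (1 + f)) (subst (IsGenerator p) (g-shift f) gen-g)
      , Equivalence.to (isGenerator⇔coprime (suc u + f)) (subst (IsGenerator p) (h-shift f) gen-h))
    (λ (2∣f , 1+f⊥n , 1+u+f⊥n) →
      let qr = Equivalence.from (isQR⇔even 2∣n f) 2∣f in
        (qr , subst (IsGenerator p) (sym (g-shift f)) (Equivalence.from (isGenerator⇔coprime (1 + f)) 1+f⊥n))
      , (qr , subst (IsGenerator p) (sym (h-shift f)) (Equivalence.from (isGenerator⇔coprime (suc u + f)) 1+u+f⊥n)))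

  Mset⇒missing : ∀ e → Mset p g h (pow e) → MissingExponent u e
  Mset⇒missing e (gen , not-hit) = e⊥n , ¬2+e⊥n , ¬u+e⊥n
    where
    e⊥n = Equivalence.to (isGenerator⇔coprime e) gen
    2∣1+e = odd⇒even-suc (coprime-even⇒odd 2∣n e⊥n)
    ¬2+e⊥n : ¬ Coprime (2 + e) n
    ¬2+e⊥n 2+e⊥n = not-hit (pow (1 + e)
      , Equivalence.from (I⇔ (1 + e)) (2∣1+e , 2+e⊥n , coprime-+n (g⁻¹g e) e⊥n)
      , inj₂ (sym (trans (h-shift (1 + e)) (trans (cong pow (g⁻¹g e)) (pow-+n e)))))
    ¬u+e⊥n : ¬ Coprime (u + e) n
    ¬u+e⊥n u+e⊥n = not-hit (pow (suc u + e)
      , Equivalence.from (I⇔ (suc u + e))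
          ( subst (2 ∣_) (+-suc u e) (∣m∣n⇒∣m+n 2∣u 2∣1+e)
          , coprime-+n (gg⁻¹ e) e⊥n
          , coprime-+n (g⁻¹g⁻¹ e) u+e⊥n)
      , inj₁ (sym (trans (g-shift (suc u + e)) (trans (cong pow (gg⁻¹ e)) (pow-+n e)))))

  missing⇒Mset : ∀ e → MissingExponent u e → Mset p g h (pow e)
  missing⇒Mset e (e⊥n , ¬2+e⊥n , ¬u+e⊥n) = Equivalence.from (isGenerator⇔coprime e) e⊥n , not-hit
    where
    excluded : ∀ f → 2 ∣ f × Coprime (1 + f) n × Coprime (suc u + f) n →
      ¬ (pow e ≡ g * pow f % p ⊎ pow e ≡ h * pow f % p)
    excluded f (_ , _ , 1+u+f⊥n) (inj₁ e≡g·r) = ¬u+e⊥n (coprime-% (sym u+e≡1+u+f) 1+u+f⊥n)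
      where
      u+e≡1+u+f : (u + e) % n ≡ (suc u + f) % n
      u+e≡1+u+f = trans (%-+-congˡ u {n = n} (pow-≡⇒%≡ {e} {1 + f} (trans e≡g·r (g-shift f))))
                        (cong (_% n) (+-suc u f))
    excluded f (_ , 1+f⊥n , _) (inj₂ e≡h·r) = ¬2+e⊥n (coprime-% (sym 2+e≡1+f) 1+f⊥n)
      where
      identity : ∀ u f → 2 + (suc u + f) ≡ (1 + f) + (2 + u)
      identity = solve-∀
      2+e≡1+f : (2 + e) % n ≡ (1 + f) % n
      2+e≡1+f = trans (%-+-congˡ 2 {n = n} (pow-≡⇒%≡ {e} {suc u + f} (trans e≡h·r (h-shift f))))
                      (trans (cong (_% n) (identity u f)) ([m+n]%n≡m%n (1 + f) n))
    not-hit : ¬ (∃[ r ] (Iset p g h r × (pow e ≡ g * r % p ⊎ pow e ≡ h * r % p)))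
    not-hit (r , r∈I , hit) with log (proj₁ (proj₁ (proj₁ r∈I)))
    ... | f , refl = excluded f (Equivalence.to (I⇔ f) r∈I) hit

  M⇔ : ∀ e → Mset p g h (pow e) ⇔ MissingExponent u e
  M⇔ e = mk⇔ (Mset⇒missing e) (missing⇒Mset e)

  M-size : HasSize (Mset p g h) (count (missing? u) n)
  M-size = hasSize (missing? u) (λ x∈M → proj₁ (proj₁ x∈M)) (λ e _ → M⇔ e)

  NI-size : HasSize (NIset p g h) (count (ni? u) n)
  NI-size = hasSize (ni? u) (λ x∈NI → proj₁ (proj₁ (proj₁ x∈NI))) (λ e _ → NI⇔ e)

-- Counting the exponents

∏ℤ-cong : ∀ m {f g : Fin m → ℤ} → (∀ i → f i ≡ g i) → ∏ℤ m f ≡ ∏ℤ m g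
∏ℤ-cong zero    f≗g = refl
∏ℤ-cong (suc m) f≗g = cong₂ ℤ._*_ (f≗g Fin.zero) (∏ℤ-cong m (λ i → f≗g (Fin.suc i)))

∏ℤ-+ : ∀ m (f : Fin m → ℕ) → ∏ℤ m (λ i → + f i) ≡ + ∏ m f
∏ℤ-+ zero    f = refl
∏ℤ-+ (suc m) f = trans (cong (λ z → + f Fin.zero ℤ.* z) (∏ℤ-+ m (λ i → f (Fin.suc i))))
                       (sym (ℤ.pos-* (f Fin.zero) (∏ m (λ i → f (Fin.suc i)))))

∏ℤ-∸ : ∀ m (f : Fin m → ℕ) c → (∀ i → c ≤ f i) → ∏ℤ m (λ i → + f i ℤ.- + c) ≡ + ∏ m (λ i → f i ∸ c)
∏ℤ-∸ m f c c≤f =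
  trans (∏ℤ-cong m (λ i → trans (ℤ.m-n≡m⊖n (f i) c) (ℤ.⊖-≥ (c≤f i)))) (∏ℤ-+ m (λ i → f i ∸ c))

exclusion-ℤ : ∀ m t Q P₁ P₂ P₃ → m + t * P₂ + t * P₂ ≡ t * P₁ + t * P₃ →
  + m ℤ.* + Q ≡ + (Q * t) ℤ.* (+ P₁ ℤ.- + 2 ℤ.* + P₂ ℤ.+ + P₃)
exclusion-ℤ m t Q P₁ P₂ P₃ h = ℤ.i-j≡0⇒i≡j _ _ (begin
  + m ℤ.* + Q ℤ.- + (Q * t) ℤ.* X         ≡⟨ cong (λ z → + m ℤ.* + Q ℤ.- z ℤ.* X) (ℤ.pos-* Q t) ⟩
  + m ℤ.* + Q ℤ.- + Q ℤ.* + t ℤ.* X       ≡⟨ identity (+ m) (+ t) (+ Q) (+ P₁) (+ P₂) (+ P₃) ⟩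
  (L ℤ.- R) ℤ.* + Q                        ≡⟨ cong (λ z → (z ℤ.- R) ℤ.* + Q) hℤ ⟩
  (R ℤ.- R) ℤ.* + Q                        ≡⟨ cong (ℤ._* + Q) (ℤ.+-inverseʳ R) ⟩
  + 0                                      ∎)
  where
  open ≡-Reasoning
  X = + P₁ ℤ.- + 2 ℤ.* + P₂ ℤ.+ + P₃
  L = + m ℤ.+ + t ℤ.* + P₂ ℤ.+ + t ℤ.* + P₂
  R = + t ℤ.* + P₁ ℤ.+ + t ℤ.* + P₃
  identity : ∀ M T Q P₁ P₂ P₃ →
    M ℤ.* Q ℤ.- Q ℤ.* T ℤ.* (P₁ ℤ.- + 2 ℤ.* P₂ ℤ.+ P₃)
      ≡ (M ℤ.+ T ℤ.* P₂ ℤ.+ T ℤ.* P₂ ℤ.- (T ℤ.* P₁ ℤ.+ T ℤ.* P₃)) ℤ.* Q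
  identity = ℤ-Solver.solve-∀
  pos-+* : ∀ a b c → + (a + b * c) ≡ + a ℤ.+ + b ℤ.* + c
  pos-+* a b c = trans (ℤ.pos-+ a (b * c)) (cong (λ z → + a ℤ.+ z) (ℤ.pos-* b c))
  hℤ : L ≡ R
  hℤ = begin
    L                             ≡⟨ cong (ℤ._+ + t ℤ.* + P₂) (pos-+* m t P₂) ⟨
    + (m + t * P₂) ℤ.+ + t ℤ.* + P₂ ≡⟨ pos-+* (m + t * P₂) t P₂ ⟨
    + (m + t * P₂ + t * P₂)        ≡⟨ cong +_ h ⟩
    + (t * P₁ + t * P₃)            ≡⟨ pos-+* (t * P₁) t P₃ ⟩
    + (t * P₁) ℤ.+ + t ℤ.* + P₃    ≡⟨ cong (ℤ._+ + t ℤ.* + P₃) (ℤ.pos-* t P₁) ⟩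
    R                              ∎

module SieveCounts (u s k : ℕ) (q α : Fin k → ℕ) (s≥1 : 1 ≤ s) (q-prime : ∀ j → Prime (q j))
                   (q≢2 : ∀ j → q j ≢ 2) (q-injective : Injective _≡_ _≡_ q) (α≥1 : ∀ j → 1 ≤ α j)
                   (n≡ : 2 + u ≡ 2 ^ s * ∏ k (λ j → q j ^ α j)) where

  n : ℕ
  n = 2 + u

  r α′ : Fin (suc k) → ℕ
  r Fin.zero    = 2
  r (Fin.suc j) = q j
  α′ Fin.zero    = s
  α′ (Fin.suc j) = α j

  r-prime : ∀ i → Prime (r i)
  r-prime Fin.zero    = prime[2]
  r-prime (Fin.suc j) = q-prime j

  r-injective : Injective _≡_ _≡_ r
  r-injective {Fin.zero}  {Fin.zero}  _    = refl
  r-injective {Fin.zero}  {Fin.suc j} 2≡qⱼ = ⊥-elim (q≢2 j (sym 2≡qⱼ))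
  r-injective {Fin.suc i} {Fin.zero}  qᵢ≡2 = ⊥-elim (q≢2 i qᵢ≡2)
  r-injective {Fin.suc i} {Fin.suc j} qᵢ≡qⱼ = cong Fin.suc (q-injective qᵢ≡qⱼ)

  α′≥1 : ∀ i → 1 ≤ α′ i
  α′≥1 Fin.zero    = s≥1
  α′≥1 (Fin.suc j) = α≥1 j

  coprime⇔ : ∀ a → Coprime a n ⇔ (∀ i → ¬ r i ∣ a)
  coprime⇔ a =
    subst (λ N → Coprime a N ⇔ (∀ i → ¬ r i ∣ a)) (sym n≡) (coprime-∏^⇔ (suc k) r α′ r-prime α′≥1)

  2∣u : 2 ∣ u
  2∣u = ∣m+n∣m⇒∣n (subst (2 ∣_) (sym n≡) (∣m⇒∣m*n _ (∣^ s≥1))) ∣-refl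

  q∣n : ∀ j → q j ∣ n
  q∣n j = subst (q j ∣_) (sym n≡) (∣n⇒∣m*n (2 ^ s) (∣-trans (∣^ (α≥1 j)) (∣∏ k (λ j → q j ^ α j) j)))

  q∤2 : ∀ j → ¬ q j ∣ 2
  q∤2 j qⱼ∣2 = q≢2 j (≤-antisym (∣⇒≤ qⱼ∣2) (prime>1 (q-prime j)))

  q∤4 : ∀ j → ¬ q j ∣ 4
  q∤4 j qⱼ∣4 with euclidsLemma 2 2 (q-prime j) qⱼ∣4
  ... | inj₁ qⱼ∣2 = q∤2 j qⱼ∣2
  ... | inj₂ qⱼ∣2 = q∤2 j qⱼ∣2

  ∏r∣n : ∏ (suc k) r ∣ 2 ^ s * ∏ k (λ j → q j ^ α j)
  ∏r∣n = ∏-mono-∣ (suc k) r (λ i → r i ^ α′ i) (λ i → ∣^ (α′≥1 i))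

  t : ℕ
  t = quotient ∏r∣n

  n≡∏r*t : n ≡ ∏ (suc k) r * t
  n≡∏r*t = trans n≡ (m∣n⇒n≡m*quotient ∏r∣n)

  -- The prime 2 gets the single shift σ, which fixes the parity of e.
  shifts : ℕ → List ℕ → Fin (suc k) → List ℕ
  shifts σ L Fin.zero    = σ ∷ []
  shifts σ L (Fin.suc j) = L

  P : ℕ → ℕ
  P c = ∏ k (λ j → q j ∸ c)

  count-shifts : ∀ σ L → (∀ j → AllPairs (Incongruent (q j)) L) →
    count (sieved? (suc k) r (shifts σ L)) n ≡ t * P (length L)
  count-shifts σ L L-incongruent = begin
    count (sieved? (suc k) r (shifts σ L)) n
      ≡⟨ cong (count (sieved? (suc k) r (shifts σ L))) n≡∏r*t ⟩
    count (sieved? (suc k) r (shifts σ L)) (∏ (suc k) r * t)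
      ≡⟨ count-periodic (sieved? (suc k) r (shifts σ L)) (∏ (suc k) r) t
           (λ x t → sieved-periodic (suc k) r (shifts σ L) (λ i → ∣m⇒∣m*n t (∣∏ (suc k) r i)) x) ⟩
    t * count (sieved? (suc k) r (shifts σ L)) (∏ (suc k) r)
      ≡⟨ cong (t *_) (count-sieved (suc k) r (shifts σ L) r-prime r-injective shifts-incongruent) ⟩
    t * (1 * P (length L))
      ≡⟨ cong (t *_) (*-identityˡ (P (length L))) ⟩
    t * P (length L) ∎
    where
    open ≡-Reasoning
    shifts-incongruent : ∀ i → AllPairs (Incongruent (r i)) (shifts σ L i)
    shifts-incongruent Fin.zero    = [] ∷ []
    shifts-incongruent (Fin.suc j) = L-incongruent j

  shifts-coprime⇔sieved : ∀ σ L → All (λ s → ∃[ d ] 2 ∣ d × s ≡ σ + d) L → ∀ e →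
    (¬ 2 ∣ σ + e × All (λ s → Coprime (s + e) n) L) ⇔ Sieved (suc k) r (shifts σ L) e
  shifts-coprime⇔sieved σ L same-parity e = mk⇔ to from
    where
    to : ¬ 2 ∣ σ + e × All (λ s → Coprime (s + e) n) L → Sieved (suc k) r (shifts σ L) e
    to (2∤σ+e , coprimes) Fin.zero    = 2∤σ+e ∷ []
    to (2∤σ+e , coprimes) (Fin.suc j) = All.map qⱼ∤ coprimes
      where
      qⱼ∤ : ∀ {s} → Coprime (s + e) n → ¬ q j ∣ s + e
      qⱼ∤ {s} s+e⊥n = Equivalence.to (coprime⇔ (s + e)) s+e⊥n (Fin.suc j)
    odd : ∀ {s} → ∃[ d ] 2 ∣ d × s ≡ σ + d → ¬ 2 ∣ σ + e → ¬ 2 ∣ s + e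
    odd (d , 2∣d , refl) 2∤σ+e 2∣s+e = 2∤σ+e (∣m+n∣m⇒∣n (subst (2 ∣_) (rearrange σ d e) 2∣s+e) 2∣d)
      where
      rearrange : ∀ σ d e → σ + d + e ≡ d + (σ + e)
      rearrange = solve-∀
    from : Sieved (suc k) r (shifts σ L) e → ¬ 2 ∣ σ + e × All (λ s → Coprime (s + e) n) L
    from sieved = All.head (sieved Fin.zero) , All.tabulate coprime
      where
      coprime : ∀ {s} → s ∈ L → Coprime (s + e) n
      coprime {s} s∈L = Equivalence.from (coprime⇔ (s + e)) λ where
        Fin.zero    → odd (All.lookup same-parity s∈L) (All.head (sieved Fin.zero))
        (Fin.suc j) → All.lookup (sieved (Fin.suc j)) s∈L

  2∣n : 2 ∣ n
  2∣n = ∣m∣n⇒∣m+n ∣-refl 2∣u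

  coprime-with : ∀ L → Decidable (λ e → Coprime e n × All (λ s → Coprime (s + e) n) L)
  coprime-with L e = coprime? e n ×-dec all? (λ s → coprime? (s + e) n) L

  even-with : ∀ L → Decidable (λ e → 2 ∣ e × All (λ s → Coprime (s + e) n) L)
  even-with L e = 2 ∣? e ×-dec all? (λ s → coprime? (s + e) n) L

  count-coprime-with : ∀ L → All (2 ∣_) L → (∀ j → AllPairs (Incongruent (q j)) (0 ∷ L)) →
    count (coprime-with L) n ≡ t * P (suc (length L))
  count-coprime-with L L-even incongruent = trans
    (count-cong (coprime-with L) n (sieved? (suc k) r (shifts 0 (0 ∷ L)))
      (λ e _ → ⇔.trans (as-shifts e) (shifts-coprime⇔sieved 0 (0 ∷ L) same-parity e)))
    (count-shifts 0 (0 ∷ L) incongruent)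
    where
    as-shifts : ∀ e →
      (Coprime e n × All (λ s → Coprime (s + e) n) L) ⇔ (¬ 2 ∣ e × All (λ s → Coprime (s + e) n) (0 ∷ L))
    as-shifts e = mk⇔ (λ (e⊥n , coprimes) → coprime-even⇒odd 2∣n e⊥n , e⊥n ∷ coprimes)
                      (λ (_ , coprimes) → All.head coprimes , All.tail coprimes)
    same-parity : All (λ s → ∃[ d ] 2 ∣ d × s ≡ 0 + d) (0 ∷ L)
    same-parity = (0 , (2 ∣0) , refl) ∷ All.map (λ {s} 2∣s → s , 2∣s , refl) L-even

  count-even-with : ∀ L → All (λ s → ∃[ d ] 2 ∣ d × s ≡ 1 + d) L → (∀ j → AllPairs (Incongruent (q j)) L) →
    count (even-with L) n ≡ t * P (length L)
  count-even-with L L-odd incongruent = trans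
    (count-cong (even-with L) n (sieved? (suc k) r (shifts 1 L))
      (λ e _ → ⇔.trans (as-shifts e) (shifts-coprime⇔sieved 1 L L-odd e)))
    (count-shifts 1 L incongruent)
    where
    as-shifts : ∀ e → (2 ∣ e × All (λ s → Coprime (s + e) n) L) ⇔ (¬ 2 ∣ 1 + e × All (λ s → Coprime (s + e) n) L)
    as-shifts e = mk⇔ (λ (2∣e , coprimes) → even⇒odd-suc 2∣e , coprimes)
                      (λ (2∤1+e , coprimes) → odd-suc⇒even 2∤1+e , coprimes)

  0≢2 : ∀ j → Incongruent (q j) 0 2
  0≢2 j = incongruent-sym (incongruent-offset 2 0 (q j ∣0) (q∤2 j) identity)
    where
    identity : ∀ y → 0 + y + 2 ≡ 2 + y + 0
    identity = solve-∀

  0≢u : ∀ j → Incongruent (q j) 0 u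
  0≢u j = incongruent-offset 2 n (q∣n j) (q∤2 j) (identity u)
    where
    identity : ∀ u y → u + y + 2 ≡ 0 + y + (2 + u)
    identity = solve-∀

  2≢u : ∀ j → Incongruent (q j) 2 u
  2≢u j = incongruent-offset 4 n (q∣n j) (q∤4 j) (identity u)
    where
    identity : ∀ u y → u + y + 4 ≡ 2 + y + (2 + u)
    identity = solve-∀

  1≢1+u : ∀ j → Incongruent (q j) 1 (suc u)
  1≢1+u j = incongruent-offset 2 n (q∣n j) (q∤2 j) (identity u)
    where
    identity : ∀ u y → suc u + y + 2 ≡ 1 + y + (2 + u)
    identity = solve-∀

  missing-count : count (missing? u) n + t * P 2 + t * P 2 ≡ t * P 1 + t * P 3
  missing-count = begin
    count (missing? u) n + t * P 2 + t * P 2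
      ≡⟨ cong₂ (λ a b → count (missing? u) n + a + b)
           (count-coprime-with (2 ∷ []) (∣-refl ∷ []) (λ j → (0≢2 j ∷ []) ∷ [] ∷ []))
           (count-coprime-with (u ∷ []) (2∣u ∷ []) (λ j → (0≢u j ∷ []) ∷ [] ∷ [])) ⟨
    count (missing? u) n + count (coprime-with (2 ∷ [])) n + count (coprime-with (u ∷ [])) n
      ≡⟨ count-exclusion (λ e → coprime? e n) (λ s e → coprime? (s + e) n) 2 u n ⟩
    count (coprime-with []) n + count (coprime-with (2 ∷ u ∷ [])) n
      ≡⟨ cong₂ _+_ (count-coprime-with [] [] (λ j → [] ∷ []))
           (count-coprime-with (2 ∷ u ∷ []) (∣-refl ∷ 2∣u ∷ [])
             (λ j → (0≢2 j ∷ 0≢u j ∷ []) ∷ (2≢u j ∷ []) ∷ [] ∷ [])) ⟩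
    t * P 1 + t * P 3 ∎
    where open ≡-Reasoning

  ni-count : count (ni? u) n + t * P 1 + t * P 1 ≡ t * P 0 + t * P 2
  ni-count = begin
    count (ni? u) n + t * P 1 + t * P 1
      ≡⟨ cong₂ (λ a b → count (ni? u) n + a + b)
           (count-even-with (1 ∷ []) ((0 , (2 ∣0) , refl) ∷ []) (λ j → [] ∷ []))
           (count-even-with (suc u ∷ []) ((u , 2∣u , refl) ∷ []) (λ j → [] ∷ [])) ⟨
    count (ni? u) n + count (even-with (1 ∷ [])) n + count (even-with (suc u ∷ [])) n
      ≡⟨ count-exclusion (2 ∣?_) (λ s e → coprime? (s + e) n) 1 (suc u) n ⟩
    count (even-with []) n + count (even-with (1 ∷ suc u ∷ [])) n
      ≡⟨ cong₂ _+_ (count-even-with [] [] (λ j → []))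
           (count-even-with (1 ∷ suc u ∷ []) ((0 , (2 ∣0) , refl) ∷ (u , 2∣u , refl) ∷ [])
             (λ j → (1≢1+u j ∷ []) ∷ [] ∷ [])) ⟩
    t * P 0 + t * P 2 ∎
    where open ≡-Reasoning

  3≤q : ∀ j → 3 ≤ q j
  3≤q j = ≤∧≢⇒< (prime>1 (q-prime j)) (≢-sym (q≢2 j))

  ∏ℤ-P : ∀ c → c ≤ 3 → ∏ℤ k (λ j → + q j ℤ.- + c) ≡ + P c
  ∏ℤ-P c c≤3 = ∏ℤ-∸ k q c (λ j → ≤-trans c≤3 (3≤q j))

  missing-formula : + count (missing? u) n ℤ.* + (2 * ∏ k q) ≡ + n ℤ.*
    (∏ℤ k (λ j → + q j ℤ.- + 1) ℤ.- + 2 ℤ.* ∏ℤ k (λ j → + q j ℤ.- + 2) ℤ.+ ∏ℤ k (λ j → + q j ℤ.- + 3))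
  missing-formula = trans (exclusion-ℤ _ t (2 * ∏ k q) (P 1) (P 2) (P 3) missing-count)
    (cong₂ ℤ._*_ (cong +_ (sym n≡∏r*t))
      (sym (cong₂ ℤ._+_ (cong₂ (λ a b → a ℤ.- + 2 ℤ.* b) (∏ℤ-P 1 (s≤s z≤n)) (∏ℤ-P 2 (s≤s (s≤s z≤n))))
                        (∏ℤ-P 3 ≤-refl))))

  ni-formula : + count (ni? u) n ℤ.* + (2 * ∏ k q) ≡ + n ℤ.*
    (∏ℤ k (λ j → + q j) ℤ.- + 2 ℤ.* ∏ℤ k (λ j → + q j ℤ.- + 1) ℤ.+ ∏ℤ k (λ j → + q j ℤ.- + 2))
  ni-formula = trans (exclusion-ℤ _ t (2 * ∏ k q) (P 0) (P 1) (P 2) ni-count)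
    (cong₂ ℤ._*_ (cong +_ (sym n≡∏r*t))
      (sym (cong₂ ℤ._+_ (cong₂ (λ a b → a ℤ.- + 2 ℤ.* b) (∏ℤ-+ k q) (∏ℤ-P 1 (s≤s z≤n)))
                        (∏ℤ-P 2 (s≤s (s≤s z≤n))))))

odd-prime⇒3+ : ∀ {p} → Prime p → p ≢ 2 → ∃[ u ] p ≡ 3 + u
odd-prime⇒3+ {0}                 p-prime _   = ⊥-elim (<⇒≱ (prime>1 p-prime) z≤n)
odd-prime⇒3+ {1}                 p-prime _   = ⊥-elim (<-irrefl refl (prime>1 p-prime))
odd-prime⇒3+ {2}                 _       p≢2 = ⊥-elim (p≢2 refl)
odd-prime⇒3+ {suc (suc (suc u))} _       _   = u , refl

theorem1p1 : (p : ℕ) .{{_ : NonZero p}} → Prime p → ¬ (p ≡ 2) →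
    (s k : ℕ) (q α : Fin k → ℕ) → 1 ≤ s →
    (∀ j → Prime (q j)) → (∀ j → ¬ (q j ≡ 2)) → Injective _≡_ _≡_ q →
    (∀ j → 1 ≤ α j) →
    p ∸ 1 ≡ 2 ^ s * ∏ k (λ j → q j ^ α j) →
    (g h : ℕ) → IsGenerator p g → IsInverse p g h →
    (∃[ m ] (HasSize (Mset p g h) m ×
      (+ m) ℤ.* (+ (2 * ∏ k q)) ≡ (+ (p ∸ 1)) ℤ.*
        (∏ℤ k (λ j → + q j ℤ.- + 1) ℤ.- + 2 ℤ.* ∏ℤ k (λ j → + q j ℤ.- + 2)
          ℤ.+ ∏ℤ k (λ j → + q j ℤ.- + 3))))
    × (∃[ n ] (HasSize (NIset p g h) n ×
      (+ n) ℤ.* (+ (2 * ∏ k q)) ≡ (+ (p ∸ 1)) ℤ.*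
        (∏ℤ k (λ j → + q j) ℤ.- + 2 ℤ.* ∏ℤ k (λ j → + q j ℤ.- + 1)
          ℤ.+ ∏ℤ k (λ j → + q j ℤ.- + 2))))
theorem1p1 p p-prime p≢2 s k q α s≥1 q-prime q≢2 q-injective α≥1 p-1≡ g h g-gen h-inv
  with odd-prime⇒3+ p-prime p≢2
... | u , refl = (count (missing? u) n , M-size , missing-formula) , (count (ni? u) n , NI-size , ni-formula)
  where
  open SieveCounts u s k q α s≥1 q-prime q≢2 q-injective α≥1 p-1≡ using (n; 2∣u; missing-formula; ni-formula)
  open ExponentSets u p-prime g-gen h-inv 2∣u using (M-size; NI-size)
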